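{- Let $I=(G=(V,A),w,S,T,\ell)$ be a yes-instance of the problem defined in the context. Then there exists a solution $K\subseteq A$ (together with a bijection $f$) such that the underlying undirected graph of the edge set $K$ is a forest.
   Context: Consider the following problem. Input: a directed graph $G=(V,A)$, an edge-weight function $w\colon A\to\mathbb{Q}_{\ge 0}$, two multisets $S$ and $T$ of vertices of $G$ with $|S|=|T|$, and an integer $\ell$. Question: is there a set $K\subseteq A$ of edges of total weight at most $\ell$ and a bijection $f\colon S\to T$ (between the multisets, counting multiplicities) such that for each $s\in S$ there is a directed path from $s$ to $f(s)$ using only edges of $K$? Such a $K$ is a solution. The underlying undirected graph of a set of directed edges is obtained by replacing each directed edge $(u,v)$ by the undirected edge $\{u,v\}$ and removing duplicates. -}

module Defs where

open import Data.Nat using (ℕ; suc)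
open import Data.Integer using (ℤ)
open import Data.Rational using (ℚ; 0ℚ; _+_; _≤_; _/_)
open import Data.Fin using (Fin; zero; suc; inject₁; fromℕ)
open import Data.Fin.Permutation using (Permutation′; _⟨$⟩ʳ_)
open import Data.Bool using (Bool; true; if_then_else_)
open import Data.List using (List; foldr; map; concatMap; allFin)
open import Data.Product using (Σ; ∃; _×_; _,_)
open import Data.Sum using (_⊎_)
open import Data.Empty using (⊥)
open import Relation.Nullary using (¬_)
open import Relation.Binary.PropositionalEquality using (_≡_)
open import Relation.Binary.Construct.Closure.ReflexiveTransitive using (Star)
open import Function.Definitions using (Injective)

-- A directed graph on vertex set V = Fin n is given by its arc relation
-- A u v ≡ true  iff  (u , v) ∈ A.  A set of arcs K ⊆ V × V likewise.
ArcSet : ℕ → Set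
ArcSet n = Fin n → Fin n → Bool

_⊆ᴬ_ : {n : ℕ} → ArcSet n → ArcSet n → Set
K ⊆ᴬ A = ∀ u v → K u v ≡ true → A u v ≡ true

weight : {n : ℕ} → (Fin n → Fin n → ℚ) → ArcSet n → ℚ
weight {n} w K =
  foldr _+_ 0ℚ
    (concatMap (λ u → map (λ v → if K u v then w u v else 0ℚ) (allFin n)) (allFin n))

Arc : {n : ℕ} → ArcSet n → Fin n → Fin n → Set
Arc K u v = K u v ≡ true

Path : {n : ℕ} → ArcSet n → Fin n → Fin n → Set
Path K = Star (Arc K)

-- Multisets S, T of k vertices each are given as lists Fin k → Fin n
-- (multiplicities counted); a bijection between the multisets is a
-- permutation σ of the k positions.
IsSolution : {n k : ℕ} → ArcSet n → (Fin n → Fin n → ℚ) →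
             (S T : Fin k → Fin n) → ℤ → ArcSet n → Set
IsSolution {n} {k} A w S T ℓ K =
  (K ⊆ᴬ A) × (weight w K ≤ (ℓ / 1)) ×
  ∃ λ (σ : Permutation′ k) → ∀ i → Path K (S i) (T (σ ⟨$⟩ʳ i))

Adj : {n : ℕ} → ArcSet n → Fin n → Fin n → Set
Adj K u v = (K u v ≡ true) ⊎ (K v u ≡ true)

-- A cycle of length ≥ 3 in the underlying undirected simple graph:
-- distinct vertices c 0, …, c (m+2), consecutive ones adjacent, last adjacent to first.
Cycle : {n : ℕ} → ArcSet n → Set
Cycle {n} K =
  ∃ λ (m : ℕ) → ∃ λ (c : Fin (suc (suc (suc m))) → Fin n) →
    Injective _≡_ _≡_ c ×
    (∀ (i : Fin (suc (suc m))) → Adj K (c (inject₁ i)) (c (suc i))) ×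
    Adj K (c (fromℕ (suc (suc m)))) (c zero)

-- Forest: no loops (a loop is a cycle of length 1) and no cycles.
Forest : {n : ℕ} → ArcSet n → Set
Forest {n} K = (∀ (u : Fin n) → ¬ (K u u ≡ true)) × ¬ Cycle K

{-# OPTIONS --safe #-}
-- Summing the k paths of a solution K gives an integral flow x from S to T that is supported
-- in K and carries nothing on loops. While the support of x contains an undirected cycle, let Δ
-- be the least flow on an arc a of the cycle, and move Δ units around the cycle: decrease by Δ
-- every arc of the cycle oriented like a and increase every arc oriented the other way. The net
-- flow at each vertex is unchanged, no arc goes negative, and a is emptied, so the support
-- shrinks. The final flow is still a flow from S to T; following positive arcs from each source
-- until a sink is reached decomposes it into k paths, which route S onto T inside a forest
-- K′ ⊆ K, and K′ weighs at most as much as K because all weights are nonnegative.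
module Submission where

open import Defs
open import Data.Nat using (ℕ)
open import Data.Integer using (ℤ)
open import Data.Rational using (ℚ; 0ℚ)
open import Data.Fin using (Fin)
open import Data.Product using (∃; _×_; _,_)
open import Data.Fin.Permutation using (Permutation′; _⟨$⟩ʳ_; _∘ₚ_)

module Flows where

  open import Data.Nat using (zero; suc; _+_; _*_; _∸_; _≤_; _<_; z≤n; s≤s; s≤s⁻¹)
  open import Data.Nat.Properties
  open import Data.Nat.Tactic.RingSolver using (solve)
  open import Algebra.Properties.Semiring.Sum +-*-semiring
    using (sum; sum-cong-≗; sum-replicate-zero; sum-remove; sum-init-last; ∑-distrib-+; ∑-comm;
           *-distribˡ-sum; *-distribʳ-sum)
  open import Algebra.Properties.CommutativeSemigroup +-commutativeSemigroup using (x∙yz≈y∙xz)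
  open import Data.Bool using (Bool; true; false; not; if_then_else_)
  open import Data.Bool.Properties using () renaming (_≟_ to _≟ᵇ_)
  open import Data.Fin using (zero; suc; inject₁; fromℕ; toℕ; fromℕ<)
  open import Data.Fin.Properties
    using (any?; all?; injective⇒≤; toℕ-fromℕ<; toℕ-inject₁; punchInᵢ≢i) renaming (_≟_ to _≟ᶠ_)
  open import Data.Fin.Permutation using (id; insert; insert-punchIn)
  open import Data.Vec.Functional as Vector using (removeAt)
  open import Data.List using (_∷_; []; allFin)
  open import Data.List.Extrema.Nat using (argmin; f[argmin]≤f[xs])
  open import Data.List.Relation.Unary.All using (lookup)
  open import Data.List.Membership.Propositional.Properties using (∈-allFin)
  open import Data.Product using (proj₁; proj₂)
  open import Data.Sum using (_⊎_; inj₁; inj₂)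
  open import Function using (_∘′_)
  open import Function.Definitions using (Injective)
  open import Relation.Nullary using (¬_; Dec; yes; no; contradiction)
  open import Relation.Nullary.Decidable using (map′; _×-dec_; _⊎-dec_; _→-dec_)
  open import Relation.Binary.PropositionalEquality
  open import Relation.Binary.Construct.Closure.ReflexiveTransitive using (ε; _◅_)

  private variable
    n k p q : ℕ

  -- Finite sums

  sum-zero : {f : Fin p → ℕ} → (∀ i → f i ≡ 0) → sum f ≡ 0
  sum-zero {p} f≡0 = trans (sum-cong-≗ f≡0) (sum-replicate-zero p)

  sum-single : (i : Fin (suc p)) {f : Fin (suc p) → ℕ} → (∀ j → j ≢ i → f j ≡ 0) → sum f ≡ f i
  sum-single i {f} others≡0 = begin
    sum f                       ≡⟨ sum-remove f ⟩
    f i + sum (removeAt f i)    ≡⟨ cong (f i +_) (sum-zero (λ j → others≡0 _ (punchInᵢ≢i i j))) ⟩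
    f i + 0                     ≡⟨ +-identityʳ (f i) ⟩
    f i                         ∎
    where open ≡-Reasoning

  term≤sum : (f : Fin p → ℕ) (i : Fin p) → f i ≤ sum f
  term≤sum {suc p} f i = subst (f i ≤_) (sym (sum-remove f)) (m≤m+n (f i) _)

  sum-mono-≤ : {f g : Fin p → ℕ} → (∀ i → f i ≤ g i) → sum f ≤ sum g
  sum-mono-≤ {zero}  f≤g = z≤n
  sum-mono-≤ {suc p} f≤g = +-mono-≤ (f≤g zero) (sum-mono-≤ (λ i → f≤g (suc i)))

  sum-mono-< : {f g : Fin p → ℕ} → (∀ i → f i ≤ g i) → (i : Fin p) → f i < g i → sum f < sum g
  sum-mono-< f≤g zero    fi<gi = +-mono-<-≤ fi<gi (sum-mono-≤ (λ i → f≤g (suc i)))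
  sum-mono-< f≤g (suc i) fi<gi = +-mono-≤-< (f≤g zero) (sum-mono-< (λ i → f≤g (suc i)) i fi<gi)

  sum-positive : (f : Fin p → ℕ) → 0 < sum f → ∃ λ i → 0 < f i
  sum-positive {suc p} f 0<sum with f zero in eq
  ... | suc _ = zero , subst (0 <_) (sym eq) (s≤s z≤n)
  ... | zero  with sum-positive (λ i → f (suc i)) 0<sum
  ...   | i , 0<fi = suc i , 0<fi

  prev : Fin (suc p) → Fin (suc p)
  prev {p} zero = fromℕ p
  prev (suc i)  = inject₁ i

  sum-prev : (f : Fin (suc p) → ℕ) → sum (λ i → f (prev i)) ≡ sum f
  sum-prev {p} f = trans (+-comm (f (fromℕ p)) _) (sym (sum-init-last f))

  prev²≢id : ∀ {m} (j : Fin (suc (suc (suc m)))) → prev (prev j) ≢ j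
  prev²≢id (suc (suc j)) eq = m≢1+n+m (toℕ j) {1} (begin
    toℕ j                       ≡⟨ toℕ-inject₁ j ⟨
    toℕ (inject₁ j)             ≡⟨ toℕ-inject₁ (inject₁ j) ⟨
    toℕ (inject₁ (inject₁ j))   ≡⟨ cong toℕ eq ⟩
    suc (suc (toℕ j))           ∎)
    where open ≡-Reasoning

  δ : Fin n → Fin n → ℕ
  δ a b with a ≟ᶠ b
  ... | yes _ = 1
  ... | no  _ = 0

  δ-refl : (a : Fin n) → δ a a ≡ 1
  δ-refl a with a ≟ᶠ a
  ... | yes _  = refl
  ... | no a≢a = contradiction refl a≢a

  δ-≢ : {a b : Fin n} → a ≢ b → δ a b ≡ 0
  δ-≢ {a = a} {b} a≢b with a ≟ᶠ b
  ... | yes a≡b = contradiction a≡b a≢b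
  ... | no  _   = refl

  δ-cases : (a b : Fin n) → (a ≡ b × δ a b ≡ 1) ⊎ δ a b ≡ 0
  δ-cases a b with a ≟ᶠ b
  ... | yes a≡b = inj₁ (a≡b , refl)
  ... | no  _   = inj₂ refl

  sum-δ : (b : Fin n) → sum (λ a → δ a b) ≡ 1
  sum-δ {suc n} b = trans (sum-single b (λ _ → δ-≢)) (δ-refl b)

  -- Flows

  Flow : ℕ → Set
  Flow n = Fin n → Fin n → ℕ

  infixl 6 _⊕_
  infixr 7 _·_

  ∅ : Flow n
  ∅ _ _ = 0

  _⊕_ : Flow n → Flow n → Flow n
  (x ⊕ y) a b = x a b + y a b

  _·_ : ℕ → Flow n → Flow n
  (d · x) a b = d * x a b

  ∑ᶠ : (Fin q → Flow n) → Flow n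
  ∑ᶠ xs a b = sum (λ i → xs i a b)

  unit : Fin n → Fin n → Flow n
  unit s t a b = δ a s * δ b t

  out inn : Flow n → Fin n → ℕ
  out x v = sum (x v)
  inn x v = sum (λ u → x u v)

  total : Flow n → ℕ
  total x = sum (out x)

  out-∅ : (v : Fin n) → out ∅ v ≡ 0
  out-∅ {n} _ = sum-replicate-zero n

  inn-∅ : (v : Fin n) → inn ∅ v ≡ 0
  inn-∅ {n} _ = sum-replicate-zero n

  out-⊕ : (x y : Flow n) (v : Fin n) → out (x ⊕ y) v ≡ out x v + out y v
  out-⊕ x y v = ∑-distrib-+ (x v) (y v)

  inn-⊕ : (x y : Flow n) (v : Fin n) → inn (x ⊕ y) v ≡ inn x v + inn y v
  inn-⊕ x y v = ∑-distrib-+ (λ u → x u v) (λ u → y u v)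

  out-· : (d : ℕ) (x : Flow n) (v : Fin n) → out (d · x) v ≡ d * out x v
  out-· d x v = sym (*-distribˡ-sum d (x v))

  inn-· : (d : ℕ) (x : Flow n) (v : Fin n) → inn (d · x) v ≡ d * inn x v
  inn-· d x v = sym (*-distribˡ-sum d (λ u → x u v))

  out-∑ : (xs : Fin q → Flow n) (v : Fin n) → out (∑ᶠ xs) v ≡ sum (λ i → out (xs i) v)
  out-∑ xs v = ∑-comm (λ u i → xs i v u)

  inn-∑ : (xs : Fin q → Flow n) (v : Fin n) → inn (∑ᶠ xs) v ≡ sum (λ i → inn (xs i) v)
  inn-∑ xs v = ∑-comm (λ u i → xs i u v)

  out-unit : (s t v : Fin n) → out (unit s t) v ≡ δ v s
  out-unit s t v = begin
    sum (λ b → δ v s * δ b t)   ≡⟨ *-distribˡ-sum (δ v s) (λ b → δ b t) ⟨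
    δ v s * sum (λ b → δ b t)   ≡⟨ cong (δ v s *_) (sum-δ t) ⟩
    δ v s * 1                   ≡⟨ *-identityʳ (δ v s) ⟩
    δ v s                       ∎
    where open ≡-Reasoning

  inn-unit : (s t v : Fin n) → inn (unit s t) v ≡ δ v t
  inn-unit s t v = begin
    sum (λ a → δ a s * δ v t)   ≡⟨ *-distribʳ-sum (δ v t) (λ a → δ a s) ⟨
    sum (λ a → δ a s) * δ v t   ≡⟨ cong (_* δ v t) (sum-δ s) ⟩
    1 * δ v t                   ≡⟨ *-identityˡ (δ v t) ⟩
    δ v t                       ∎
    where open ≡-Reasoning

  total-cong : {x y : Flow n} → (∀ a b → x a b ≡ y a b) → total x ≡ total y
  total-cong x≡y = sum-cong-≗ (λ a → sum-cong-≗ (x≡y a))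

  total-⊕ : (x y : Flow n) → total (x ⊕ y) ≡ total x + total y
  total-⊕ x y = trans (sum-cong-≗ (out-⊕ x y)) (∑-distrib-+ (out x) (out y))

  total-unit : (s t : Fin n) → total (unit s t) ≡ 1
  total-unit s t = trans (sum-cong-≗ (out-unit s t)) (sum-δ s)

  unit-cases : (s t a b : Fin n) → (a ≡ s × b ≡ t × unit s t a b ≡ 1) ⊎ unit s t a b ≡ 0
  unit-cases s t a b with δ-cases a s | δ-cases b t
  ... | inj₁ (a≡s , δas≡1) | inj₁ (b≡t , δbt≡1) = inj₁ (a≡s , b≡t , cong₂ _*_ δas≡1 δbt≡1)
  ... | inj₁ _             | inj₂ δbt≡0         = inj₂ (trans (cong (δ a s *_) δbt≡0) (*-zeroʳ (δ a s)))
  ... | inj₂ δas≡0         | _                  = inj₂ (cong (_* δ b t) δas≡0)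

  unit-self : (s t : Fin n) → unit s t s t ≡ 1
  unit-self s t = cong₂ _*_ (δ-refl s) (δ-refl t)

  unit-positive : {s t a b : Fin n} → 0 < unit s t a b → a ≡ s × b ≡ t
  unit-positive {s = s} {t} {a} {b} 0<unit with unit-cases s t a b
  ... | inj₁ (a≡s , b≡t , _) = a≡s , b≡t
  ... | inj₂ unit≡0          = contradiction (subst (0 <_) unit≡0 0<unit) n≮0

  unit-≤ : {x : Flow n} {s t : Fin n} → 0 < x s t → (a b : Fin n) → unit s t a b ≤ x a b
  unit-≤ {x = x} {s} {t} 0<xst a b with unit-cases s t a b
  ... | inj₁ (refl , refl , unit≡1) = subst (_≤ x a b) (sym unit≡1) 0<xst
  ... | inj₂ unit≡0                 = subst (_≤ x a b) (sym unit≡0) z≤n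

  positive : ℕ → Bool
  positive zero    = false
  positive (suc _) = true

  0<⇒positive : {m : ℕ} → 0 < m → positive m ≡ true
  0<⇒positive {suc _} _ = refl

  positive⇒0< : {m : ℕ} → positive m ≡ true → 0 < m
  positive⇒0< {suc _} _ = s≤s z≤n

  support : Flow n → ArcSet n
  support x a b = positive (x a b)

  ⊆ᴬ-trans : {K₁ K₂ K₃ : ArcSet n} → K₁ ⊆ᴬ K₂ → K₂ ⊆ᴬ K₃ → K₁ ⊆ᴬ K₃
  ⊆ᴬ-trans K₁⊆K₂ K₂⊆K₃ a b = K₂⊆K₃ a b ∘′ K₁⊆K₂ a b

  support-mono : {x y : Flow n} → (∀ {a b} → 0 < x a b → 0 < y a b) → support x ⊆ᴬ support y
  support-mono x⇒y a b = 0<⇒positive ∘′ x⇒y ∘′ positive⇒0<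

  indicator : Bool → ℕ
  indicator b = if b then 1 else 0

  size : ArcSet n → ℕ
  size K = sum (λ a → sum (λ b → indicator (K a b)))

  size-⊂ : {K′ K : ArcSet n} → K′ ⊆ᴬ K → (a b : Fin n) → K a b ≡ true → K′ a b ≡ false →
           size K′ < size K
  size-⊂ {K′ = K′} {K} K′⊆K a b Kab K′ab =
    sum-mono-< (λ a → sum-mono-≤ (indicator-mono a)) a
      (sum-mono-< (indicator-mono a) b (subst₂ (λ p q → indicator p < indicator q) (sym K′ab) (sym Kab) ≤-refl))
    where
    indicator-mono : ∀ a b → indicator (K′ a b) ≤ indicator (K a b)
    indicator-mono a b with K′ a b in eq′ | K a b in eq
    ... | false | _     = z≤n
    ... | true  | true  = ≤-refl
    ... | true  | false with trans (sym (K′⊆K a b eq′)) eq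
    ...   | ()

  count : (Fin k → Fin n) → Fin n → ℕ
  count S v = sum (λ i → δ v (S i))

  -- Conservation with supply S and demand T, i.e. out − inn = count S − count T at every vertex.
  IsFlow : (S T : Fin k → Fin n) → Flow n → Set
  IsFlow S T x = ∀ v → out x v + count T v ≡ inn x v + count S v

  -- x − y is a circulation.
  SameNet : Flow n → Flow n → Set
  SameNet x y = ∀ v → out x v + inn y v ≡ inn x v + out y v

  SameNet-sym : {x y : Flow n} → SameNet x y → SameNet y x
  SameNet-sym {x = x} {y} x~y v = begin
    out y v + inn x v   ≡⟨ +-comm (out y v) (inn x v) ⟩
    inn x v + out y v   ≡⟨ x~y v ⟨
    out x v + inn y v   ≡⟨ +-comm (out x v) (inn y v) ⟩
    inn y v + out x v   ∎
    where open ≡-Reasoning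

  SameNet-· : (d : ℕ) {x y : Flow n} → SameNet x y → SameNet (d · x) (d · y)
  SameNet-· d {x} {y} x~y v = begin
    out (d · x) v + inn (d · y) v   ≡⟨ cong₂ _+_ (out-· d x v) (inn-· d y v) ⟩
    d * out x v + d * inn y v       ≡⟨ *-distribˡ-+ d (out x v) (inn y v) ⟨
    d * (out x v + inn y v)         ≡⟨ cong (d *_) (x~y v) ⟩
    d * (inn x v + out y v)         ≡⟨ *-distribˡ-+ d (inn x v) (out y v) ⟩
    d * inn x v + d * out y v       ≡⟨ cong₂ _+_ (inn-· d x v) (out-· d y v) ⟨
    inn (d · x) v + out (d · y) v   ∎
    where open ≡-Reasoning

  SameNet-exchange : {x x′ y z : Flow n} → (∀ a b → (x′ ⊕ y) a b ≡ (x ⊕ z) a b) →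
                     SameNet y z → SameNet x x′
  SameNet-exchange {x = x} {x′} {y} {z} x′+y≡x+z y~z v =
    exchange (out x v) (inn x v) (out x′ v) (inn x′ v) (out y v) (inn y v) (out z v) (inn z v)
      (trans (sym (out-⊕ x′ y v)) (trans (sum-cong-≗ (x′+y≡x+z v)) (out-⊕ x z v)))
      (trans (sym (inn-⊕ x′ y v)) (trans (sum-cong-≗ (λ u → x′+y≡x+z u v)) (inn-⊕ x z v)))
      (y~z v)
    where
    exchange : ∀ a b a′ b′ c d e f → a′ + c ≡ a + e → b′ + d ≡ b + f → c + f ≡ d + e →
               a + b′ ≡ b + a′
    exchange a b a′ b′ c d e f a′+c≡a+e b′+d≡b+f c+f≡d+e = +-cancelʳ-≡ (c + d) _ _ (begin
      a + b′ + (c + d)   ≡⟨ solve (a ∷ b′ ∷ c ∷ d ∷ []) ⟩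
      a + c + (b′ + d)   ≡⟨ cong (a + c +_) b′+d≡b+f ⟩
      a + c + (b + f)    ≡⟨ solve (a ∷ b ∷ c ∷ f ∷ []) ⟩
      a + b + (c + f)    ≡⟨ cong (a + b +_) c+f≡d+e ⟩
      a + b + (d + e)    ≡⟨ solve (a ∷ b ∷ d ∷ e ∷ []) ⟩
      b + d + (a + e)    ≡⟨ cong (b + d +_) a′+c≡a+e ⟨
      b + d + (a′ + c)   ≡⟨ solve (b ∷ a′ ∷ c ∷ d ∷ []) ⟩
      b + a′ + (c + d)   ∎)
      where open ≡-Reasoning

  IsFlow-SameNet : {S T : Fin k → Fin n} {x y : Flow n} → IsFlow S T x → SameNet x y → IsFlow S T y
  IsFlow-SameNet {S = S} {T} {x} {y} x-flow x~y v =
    transfer (out x v) (inn x v) (out y v) (inn y v) (count S v) (count T v) (x-flow v) (x~y v)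
    where
    transfer : ∀ a b c d s t → a + t ≡ b + s → a + d ≡ b + c → c + t ≡ d + s
    transfer a b c d s t a+t≡b+s a+d≡b+c = +-cancelʳ-≡ a _ _ (begin
      c + t + a     ≡⟨ solve (a ∷ c ∷ t ∷ []) ⟩
      c + (a + t)   ≡⟨ cong (c +_) a+t≡b+s ⟩
      c + (b + s)   ≡⟨ solve (b ∷ c ∷ s ∷ []) ⟩
      b + c + s     ≡⟨ cong (_+ s) a+d≡b+c ⟨
      a + d + s     ≡⟨ solve (a ∷ d ∷ s ∷ []) ⟩
      d + s + a     ∎)
      where open ≡-Reasoning

  -- Loops carry no flow, so that flows of paths vanish on the diagonal.
  arcFlow : Fin n → Fin n → Flow n
  arcFlow s t with s ≟ᶠ t
  ... | yes _ = ∅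
  ... | no  _ = unit s t

  arcFlow-net : (s t v : Fin n) → out (arcFlow s t) v + δ v t ≡ inn (arcFlow s t) v + δ v s
  arcFlow-net s t v with s ≟ᶠ t
  ... | yes refl = refl
  ... | no  _    = begin
    out (unit s t) v + δ v t   ≡⟨ cong₂ _+_ (out-unit s t v) (sym (inn-unit s t v)) ⟩
    δ v s + inn (unit s t) v   ≡⟨ +-comm (δ v s) _ ⟩
    inn (unit s t) v + δ v s   ∎
    where open ≡-Reasoning

  arcFlow-positive : {s t a b : Fin n} → 0 < arcFlow s t a b → a ≡ s × b ≡ t
  arcFlow-positive {s = s} {t} 0<x with s ≟ᶠ t
  ... | no _ = unit-positive 0<x

  arcFlow-loopless : (s t a : Fin n) → arcFlow s t a a ≡ 0
  arcFlow-loopless s t a with s ≟ᶠ t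
  ... | yes _   = refl
  ... | no  s≢t with unit-cases s t a a
  ...   | inj₁ (refl , refl , _) = contradiction refl s≢t
  ...   | inj₂ unit≡0            = unit≡0

  Routes : ArcSet n → (S T : Fin k → Fin n) → Set
  Routes {k = k} K S T = ∃ λ (σ : Permutation′ k) → ∀ i → Path K (S i) (T (σ ⟨$⟩ʳ i))

  module _ {K : ArcSet n} where

    pathFlow : {s t : Fin n} → Path K s t → Flow n
    pathFlow ε                 = ∅
    pathFlow (_◅_ {s} {u} _ p) = arcFlow s u ⊕ pathFlow p

    pathFlow-net : {s t : Fin n} (P : Path K s t) (v : Fin n) →
                   out (pathFlow P) v + δ v t ≡ inn (pathFlow P) v + δ v s
    pathFlow-net ε v = refl
    pathFlow-net {s} {t} (_◅_ {j = u} _ p) v =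
      trans (cong (_+ δ v t) (out-⊕ (arcFlow s u) (pathFlow p) v))
        (trans (concat (out (arcFlow s u) v) (inn (arcFlow s u) v) (out (pathFlow p) v) (inn (pathFlow p) v)
                       (δ v s) (δ v u) (δ v t) (arcFlow-net s u v) (pathFlow-net p v))
               (cong (_+ δ v s) (sym (inn-⊕ (arcFlow s u) (pathFlow p) v))))
      where
      concat : ∀ a b c d s u t → a + u ≡ b + s → c + t ≡ d + u → a + c + t ≡ b + d + s
      concat a b c d s u t a+u≡b+s c+t≡d+u = begin
        a + c + t     ≡⟨ +-assoc a c t ⟩
        a + (c + t)   ≡⟨ cong (a +_) c+t≡d+u ⟩
        a + (d + u)   ≡⟨ solve (a ∷ d ∷ u ∷ []) ⟩
        a + u + d     ≡⟨ cong (_+ d) a+u≡b+s ⟩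
        b + s + d     ≡⟨ solve (b ∷ d ∷ s ∷ []) ⟩
        b + d + s     ∎
        where open ≡-Reasoning

    pathFlow-positive : {s t : Fin n} (P : Path K s t) {a b : Fin n} → 0 < pathFlow P a b → K a b ≡ true
    pathFlow-positive (_◅_ {i = s} {u} e p) {a} {b} 0<x with arcFlow s u a b in eq
    ... | zero  = pathFlow-positive p 0<x
    ... | suc _ with arcFlow-positive {s = s} {u} {a} {b} (subst (0 <_) (sym eq) (s≤s z≤n))
    ...   | refl , refl = e

    pathFlow-loopless : {s t : Fin n} (P : Path K s t) (a : Fin n) → pathFlow P a a ≡ 0
    pathFlow-loopless ε                     a = refl
    pathFlow-loopless (_◅_ {i = s} {u} _ p) a = cong₂ _+_ (arcFlow-loopless s u a) (pathFlow-loopless p a)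

    routeFlow : {S T : Fin k → Fin n} → (∀ i → Path K (S i) (T i)) → Flow n
    routeFlow P = ∑ᶠ (λ i → pathFlow (P i))

    routeFlow-isFlow : {S T : Fin k → Fin n} (P : ∀ i → Path K (S i) (T i)) → IsFlow S T (routeFlow P)
    routeFlow-isFlow {S = S} {T} P v = begin
      out (routeFlow P) v + count T v                 ≡⟨ cong (_+ count T v) (out-∑ (λ i → pathFlow (P i)) v) ⟩
      sum (λ i → out (pathFlow (P i)) v) + count T v  ≡⟨ ∑-distrib-+ (λ i → out (pathFlow (P i)) v) _ ⟨
      sum (λ i → out (pathFlow (P i)) v + δ v (T i))  ≡⟨ sum-cong-≗ (λ i → pathFlow-net (P i) v) ⟩
      sum (λ i → inn (pathFlow (P i)) v + δ v (S i))  ≡⟨ ∑-distrib-+ (λ i → inn (pathFlow (P i)) v) _ ⟩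
      sum (λ i → inn (pathFlow (P i)) v) + count S v  ≡⟨ cong (_+ count S v) (inn-∑ (λ i → pathFlow (P i)) v) ⟨
      inn (routeFlow P) v + count S v                 ∎
      where open ≡-Reasoning

    routeFlow-positive : {S T : Fin k → Fin n} (P : ∀ i → Path K (S i) (T i)) {a b : Fin n} →
                         0 < routeFlow P a b → K a b ≡ true
    routeFlow-positive P {a} {b} 0<x with sum-positive (λ i → pathFlow (P i) a b) 0<x
    ... | i , 0<xᵢ = pathFlow-positive (P i) 0<xᵢ

    routeFlow-loopless : {S T : Fin k → Fin n} (P : ∀ i → Path K (S i) (T i)) (a : Fin n) → routeFlow P a a ≡ 0
    routeFlow-loopless P a = sum-zero (λ i → pathFlow-loopless (P i) a)

  -- Deciding cycles

  ∃-function? : ∀ p {P : (Fin p → Fin n) → Set} → (∀ {f g} → f ≗ g → P f → P g) →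
                (∀ f → Dec (P f)) → Dec (∃ P)
  ∃-function? zero    resp P? = map′ (_ ,_) (λ (f , Pf) → resp (λ ()) Pf) (P? (λ ()))
  ∃-function? (suc p) resp P? =
    map′ (λ (a , f , Pa∷f) → a Vector.∷ f , Pa∷f)
         (λ (f , Pf) → f zero , (λ i → f (suc i)) , resp (λ { zero → refl ; (suc i) → refl }) Pf)
         (any? λ a → ∃-function? p (λ f≗g → resp (λ { zero → refl ; (suc i) → f≗g i }))
                                   (λ f → P? (a Vector.∷ f)))

  IsCycle : ArcSet n → (m : ℕ) → (Fin (suc (suc (suc m))) → Fin n) → Set
  IsCycle K m c = Injective _≡_ _≡_ c ×
                  (∀ (i : Fin (suc (suc m))) → Adj K (c (inject₁ i)) (c (suc i))) ×
                  Adj K (c (fromℕ (suc (suc m)))) (c zero)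

  adj? : (K : ArcSet n) (u v : Fin n) → Dec (Adj K u v)
  adj? K u v = (K u v ≟ᵇ true) ⊎-dec (K v u ≟ᵇ true)

  injective? : (c : Fin p → Fin n) → Dec (Injective _≡_ _≡_ c)
  injective? c = map′ (λ inj {i} {j} → inj i j) (λ inj i j → inj)
                      (all? λ i → all? λ j → (c i ≟ᶠ c j) →-dec (i ≟ᶠ j))

  IsCycle-resp : {K : ArcSet n} {m : ℕ} {c c′ : Fin (suc (suc (suc m))) → Fin n} → c ≗ c′ →
                 IsCycle K m c → IsCycle K m c′
  IsCycle-resp {K = K} {c = c} {c′} c≗c′ (inj , steps , closing) =
    (λ {i} {j} c′i≡c′j → inj (trans (c≗c′ i) (trans c′i≡c′j (sym (c≗c′ j))))) ,
    (λ i → adj-resp (steps i)) , adj-resp closing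
    where
    adj-resp : ∀ {i j} → Adj K (c i) (c j) → Adj K (c′ i) (c′ j)
    adj-resp {i} {j} = subst₂ (Adj K) (c≗c′ i) (c≗c′ j)

  cycle? : (K : ArcSet n) → Dec (Cycle K)
  cycle? {n} K = map′ (λ (i , cyc) → toℕ i , cyc) shorten
    (any? λ (i : Fin n) → ∃-function? _ (IsCycle-resp {K = K})
      λ c → injective? c ×-dec (all? (λ i → adj? K _ _) ×-dec adj? K _ _))
    where
    shorten : Cycle K → ∃ λ (i : Fin n) → ∃ (IsCycle K (toℕ i))
    shorten (m , c , cyc@(inj , _)) =
      fromℕ< m<n , subst (λ m → ∃ (IsCycle K m)) (sym (toℕ-fromℕ< m<n)) (c , cyc)
      where
      m<n : m < n
      m<n = ≤-trans (m≤n+m (suc m) 2) (injective⇒≤ inj)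

  -- Cycle cancellation

  ReducedSupport : Flow n → Set
  ReducedSupport x = ∃ λ y → SameNet x y × support y ⊆ᴬ support x × size (support y) < size (support x)

  module AdjArc (K : ArcSet n) {u v : Fin n} where

    arcTail arcHead : Adj K u v → Fin n
    arcTail (inj₁ _) = u
    arcTail (inj₂ _) = v
    arcHead (inj₁ _) = v
    arcHead (inj₂ _) = u

    orientation : Adj K u v → Bool
    orientation (inj₁ _) = true
    orientation (inj₂ _) = false

    oriented : Bool → Adj K u v → Flow n
    oriented true  (inj₁ _) = unit u v
    oriented false (inj₂ _) = unit v u
    oriented _     _        = ∅

    oriented-net : (e : Adj K u v) (t : Fin n) → out (oriented true e) t + inn (oriented false e) t ≡ δ t u
    oriented-net (inj₁ _) t = trans (cong₂ _+_ (out-unit u v t) (inn-∅ t)) (+-identityʳ (δ t u))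
    oriented-net (inj₂ _) t = trans (cong (_+ inn (unit v u) t) (out-∅ t)) (inn-unit v u t)

    oriented-net′ : (e : Adj K u v) (t : Fin n) → inn (oriented true e) t + out (oriented false e) t ≡ δ t v
    oriented-net′ (inj₁ _) t = trans (cong₂ _+_ (inn-unit u v t) (out-∅ t)) (+-identityʳ (δ t v))
    oriented-net′ (inj₂ _) t = trans (cong (_+ out (unit v u) t) (inn-∅ t)) (out-unit v u t)

    oriented-orientation : (e : Adj K u v) (a b : Fin n) →
                           oriented (orientation e) e a b ≡ unit (arcTail e) (arcHead e) a b
    oriented-orientation (inj₁ _) a b = refl
    oriented-orientation (inj₂ _) a b = refl

    oriented-complement : (d : Bool) (e : Adj K u v) (a b : Fin n) →
                          oriented d e a b + oriented (not d) e a b ≡ unit (arcTail e) (arcHead e) a b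
    oriented-complement true  (inj₁ _) a b = +-identityʳ _
    oriented-complement true  (inj₂ _) a b = refl
    oriented-complement false (inj₁ _) a b = refl
    oriented-complement false (inj₂ _) a b = +-identityʳ _

  module CycleCancellation {x : Flow n} {m : ℕ} {c : Fin (suc (suc (suc m))) → Fin n}
                           (cyc : IsCycle (support x) m c) where

    open AdjArc (support x)

    Step : Set
    Step = Fin (suc (suc (suc m)))

    -- Step zero is the closing edge of the cycle.
    edge : (j : Step) → Adj (support x) (c (prev j)) (c j)
    edge zero    = proj₂ (proj₂ cyc)
    edge (suc i) = proj₁ (proj₂ cyc) i

    tail head : Step → Fin n
    tail j = arcTail (edge j)
    head j = arcHead (edge j)

    adj-positive : {u v : Fin n} (e : Adj (support x) u v) → 0 < x (arcTail e) (arcHead e)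
    adj-positive (inj₁ xuv) = positive⇒0< xuv
    adj-positive (inj₂ xvu) = positive⇒0< xvu

    arc-injective : {i j : Step} → tail i ≡ tail j → head i ≡ head j → i ≡ j
    arc-injective {i} {j} = endpoints (edge i) (edge j)
      where
      c-injective : Injective _≡_ _≡_ c
      c-injective = proj₁ cyc

      endpoints : (e : Adj (support x) (c (prev i)) (c i)) (e′ : Adj (support x) (c (prev j)) (c j)) →
                  arcTail e ≡ arcTail e′ → arcHead e ≡ arcHead e′ → i ≡ j
      endpoints (inj₁ _) (inj₁ _) _     ci≡cj = c-injective ci≡cj
      endpoints (inj₂ _) (inj₂ _) ci≡cj _     = c-injective ci≡cj
      endpoints (inj₁ _) (inj₂ _) t≡ h≡ =
        contradiction (trans (cong prev (sym (c-injective h≡))) (c-injective t≡)) (prev²≢id j)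
      endpoints (inj₂ _) (inj₁ _) t≡ h≡ =
        contradiction (trans (cong prev (c-injective h≡)) (sym (c-injective t≡))) (prev²≢id i)

    Oriented : Bool → Flow n
    Oriented d = ∑ᶠ (λ j → oriented d (edge j))

    Arcs : Flow n
    Arcs = ∑ᶠ (λ j → unit (tail j) (head j))

    Oriented-balanced : SameNet (Oriented true) (Oriented false)
    Oriented-balanced t = begin
      out (Oriented true) t + inn (Oriented false) t
        ≡⟨ cong₂ _+_ (out-∑ (λ j → oriented true (edge j)) t) (inn-∑ (λ j → oriented false (edge j)) t) ⟩
      sum (λ j → out (oriented true (edge j)) t) + sum (λ j → inn (oriented false (edge j)) t)
        ≡⟨ ∑-distrib-+ (λ j → out (oriented true (edge j)) t) (λ j → inn (oriented false (edge j)) t) ⟨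
      sum (λ j → out (oriented true (edge j)) t + inn (oriented false (edge j)) t)
        ≡⟨ sum-cong-≗ (λ j → oriented-net (edge j) t) ⟩
      sum (λ j → δ t (c (prev j)))
        ≡⟨ sum-prev (λ j → δ t (c j)) ⟩
      sum (λ j → δ t (c j))
        ≡⟨ sum-cong-≗ (λ j → oriented-net′ (edge j) t) ⟨
      sum (λ j → inn (oriented true (edge j)) t + out (oriented false (edge j)) t)
        ≡⟨ ∑-distrib-+ (λ j → inn (oriented true (edge j)) t) (λ j → out (oriented false (edge j)) t) ⟩
      sum (λ j → inn (oriented true (edge j)) t) + sum (λ j → out (oriented false (edge j)) t)
        ≡⟨ cong₂ _+_ (inn-∑ (λ j → oriented true (edge j)) t) (out-∑ (λ j → oriented false (edge j)) t) ⟨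
      inn (Oriented true) t + out (Oriented false) t
        ∎
      where open ≡-Reasoning

    Oriented-SameNet : (d : Bool) → SameNet (Oriented d) (Oriented (not d))
    Oriented-SameNet true  = Oriented-balanced
    Oriented-SameNet false = SameNet-sym Oriented-balanced

    Oriented-complement : (d : Bool) (a b : Fin n) → Oriented d a b + Oriented (not d) a b ≡ Arcs a b
    Oriented-complement d a b =
      trans (sym (∑-distrib-+ (λ j → oriented d (edge j) a b) (λ j → oriented (not d) (edge j) a b)))
            (sum-cong-≗ (λ j → oriented-complement d (edge j) a b))

    Oriented≤Arcs : (d : Bool) (a b : Fin n) → Oriented d a b ≤ Arcs a b
    Oriented≤Arcs d a b =
      subst (Oriented d a b ≤_) (Oriented-complement d a b) (m≤m+n (Oriented d a b) (Oriented (not d) a b))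

    Oriented-not≤Arcs : (d : Bool) (a b : Fin n) → Oriented (not d) a b ≤ Arcs a b
    Oriented-not≤Arcs d a b =
      subst (Oriented (not d) a b ≤_) (Oriented-complement d a b) (m≤n+m (Oriented (not d) a b) (Oriented d a b))

    Arcs-positive : {a b : Fin n} → 0 < Arcs a b → ∃ λ j → a ≡ tail j × b ≡ head j
    Arcs-positive {a} {b} 0<Arcs with sum-positive (λ j → unit (tail j) (head j) a b) 0<Arcs
    ... | j , 0<unit = j , unit-positive 0<unit

    Arcs-cases : (a b : Fin n) → Arcs a b ≡ 0 ⊎ ∃ λ j → a ≡ tail j × b ≡ head j
    Arcs-cases a b with Arcs a b in eq
    ... | zero  = inj₁ refl
    ... | suc _ = inj₂ (Arcs-positive (subst (0 <_) (sym eq) (s≤s z≤n)))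

    Arcs-arc : (j : Step) → Arcs (tail j) (head j) ≡ 1
    Arcs-arc j = trans (sum-single j others) (unit-self (tail j) (head j))
      where
      others : ∀ i → i ≢ j → unit (tail i) (head i) (tail j) (head j) ≡ 0
      others i i≢j with unit-cases (tail i) (head i) (tail j) (head j)
      ... | inj₁ (tⱼ≡tᵢ , hⱼ≡hᵢ , _) = contradiction (arc-injective (sym tⱼ≡tᵢ) (sym hⱼ≡hᵢ)) i≢j
      ... | inj₂ unit≡0              = unit≡0

    load : Step → ℕ
    load j = x (tail j) (head j)

    -- Opaque: normalising argmin over allFin during type checking takes exponential time.
    opaque
      j₀ : Step
      j₀ = argmin load zero (allFin _)

      j₀-minimal : (j : Step) → load j₀ ≤ load j
      j₀-minimal j = lookup (f[argmin]≤f[xs] {f = load} zero (allFin _)) (∈-allFin j)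

    Δ : ℕ
    Δ = load j₀

    Δ·Arcs≤x : (a b : Fin n) → Δ * Arcs a b ≤ x a b
    Δ·Arcs≤x a b with Arcs-cases a b
    ... | inj₁ Arcs≡0            = subst (_≤ x a b) (sym (trans (cong (Δ *_) Arcs≡0) (*-zeroʳ Δ))) z≤n
    ... | inj₂ (j , refl , refl) = subst (_≤ load j) (sym (trans (cong (Δ *_) (Arcs-arc j)) (*-identityʳ Δ)))
                                         (j₀-minimal j)

    o : Bool
    o = orientation (edge j₀)

    -- x′ moves Δ units off the arcs oriented like j₀ onto the others.
    D U : Flow n
    D = Oriented o
    U = Oriented (not o)

    D-bounded : (a b : Fin n) → Δ * D a b ≤ x a b
    D-bounded a b = ≤-trans (*-monoʳ-≤ Δ (Oriented≤Arcs o a b)) (Δ·Arcs≤x a b)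

    U-positive : {a b : Fin n} → 0 < U a b → 0 < x a b
    U-positive {a} {b} 0<U = at-arc (Arcs-positive (≤-trans 0<U (Oriented-not≤Arcs o a b)))
      where
      at-arc : (∃ λ j → a ≡ tail j × b ≡ head j) → 0 < x a b
      at-arc (j , a≡ , b≡) = subst₂ (λ a b → 0 < x a b) (sym a≡) (sym b≡) (adj-positive (edge j))

    D-at-j₀ : 1 ≤ D (tail j₀) (head j₀)
    D-at-j₀ = begin
      1
        ≡⟨ unit-self (tail j₀) (head j₀) ⟨
      unit (tail j₀) (head j₀) (tail j₀) (head j₀)
        ≡⟨ oriented-orientation (edge j₀) (tail j₀) (head j₀) ⟨
      oriented o (edge j₀) (tail j₀) (head j₀)
        ≤⟨ term≤sum (λ j → oriented o (edge j) (tail j₀) (head j₀)) j₀ ⟩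
      D (tail j₀) (head j₀)
        ∎
      where open ≤-Reasoning

    U-at-j₀ : U (tail j₀) (head j₀) ≡ 0
    U-at-j₀ = rest D-at-j₀ (trans (Oriented-complement o (tail j₀) (head j₀)) (Arcs-arc j₀))
      where
      rest : ∀ {d u} → 1 ≤ d → d + u ≡ 1 → u ≡ 0
      rest {suc d} _ d+u≡0 = m+n≡0⇒n≡0 d (suc-injective d+u≡0)

    x′ : Flow n
    x′ a b = (x a b + Δ * U a b) ∸ Δ * D a b

    x′-exchange : (a b : Fin n) → (x′ ⊕ Δ · D) a b ≡ (x ⊕ Δ · U) a b
    x′-exchange a b = m∸n+n≡m (≤-trans (D-bounded a b) (m≤m+n _ _))

    x′-positive : {a b : Fin n} → 0 < x′ a b → 0 < x a b
    x′-positive {a} {b} 0<x′ = by-U (U a b) refl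
      where
      by-U : ∀ u → U a b ≡ u → 0 < x a b
      by-U (suc _) U≡suc = U-positive (subst (0 <_) (sym U≡suc) (s≤s z≤n))
      by-U zero    U≡0   = begin-strict
        0                   <⟨ 0<x′ ⟩
        x′ a b              ≤⟨ m∸n≤m (x a b + Δ * U a b) (Δ * D a b) ⟩
        x a b + Δ * U a b   ≡⟨ cong (λ u → x a b + Δ * u) U≡0 ⟩
        x a b + Δ * 0       ≡⟨ trans (cong (x a b +_) (*-zeroʳ Δ)) (+-identityʳ (x a b)) ⟩
        x a b               ∎
        where open ≤-Reasoning

    x′-at-j₀ : x′ (tail j₀) (head j₀) ≡ 0
    x′-at-j₀ = m≤n⇒m∸n≡0 (begin
      Δ + Δ * U (tail j₀) (head j₀)   ≡⟨ cong (λ u → Δ + Δ * u) U-at-j₀ ⟩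
      Δ + Δ * 0                       ≡⟨ trans (cong (Δ +_) (*-zeroʳ Δ)) (+-identityʳ Δ) ⟩
      Δ                               ≡⟨ *-identityʳ Δ ⟨
      Δ * 1                           ≤⟨ *-monoʳ-≤ Δ D-at-j₀ ⟩
      Δ * D (tail j₀) (head j₀)       ∎)
      where open ≤-Reasoning

    cancelCycle : ReducedSupport x
    cancelCycle =
      x′ , SameNet-exchange x′-exchange (SameNet-· Δ (Oriented-SameNet o)) , support-mono x′-positive ,
      size-⊂ (support-mono x′-positive) (tail j₀) (head j₀) (0<⇒positive (adj-positive (edge j₀)))
             (cong positive x′-at-j₀)

  AcyclicReduct : (S T : Fin k → Fin n) → Flow n → Set
  AcyclicReduct S T x = ∃ λ y → IsFlow S T y × support y ⊆ᴬ support x × ¬ Cycle (support y)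

  acyclicReduct : ∀ N {S T : Fin k → Fin n} (x : Flow n) → size (support x) < N → IsFlow S T x →
                  AcyclicReduct S T x
  acyclicReduct (suc N) {S} {T} x size<N x-flow = by-cycle? (cycle? (support x))
    where
    continue : ReducedSupport x → AcyclicReduct S T x
    continue (x₁ , x~x₁ , x₁⊆x , smaller)
      with acyclicReduct N {S} {T} x₁ (<-≤-trans smaller (s≤s⁻¹ size<N)) (IsFlow-SameNet {S = S} {T} x-flow x~x₁)
    ... | y , y-flow , y⊆x₁ , acyclic = y , y-flow , ⊆ᴬ-trans y⊆x₁ x₁⊆x , acyclic

    by-cycle? : Dec (Cycle (support x)) → AcyclicReduct S T x
    by-cycle? (no acyclic)        = x , x-flow , (λ _ _ x⊆x → x⊆x) , acyclic
    by-cycle? (yes (_ , _ , cyc)) = continue (CycleCancellation.cancelCycle cyc)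

  -- Flow decomposition

  module _ {K : ArcSet n} where

    PathAndRemainder : (u : Fin n) (S : Fin k → Fin n) (T : Fin (suc k) → Fin n) → Set
    PathAndRemainder u S T = ∃ λ j → Path K u (T j) × ∃ λ y → IsFlow S (removeAt T j) y × support y ⊆ᴬ K

    extractPath : ∀ N {S : Fin k → Fin n} {T : Fin (suc k) → Fin n} (x : Flow n) (u : Fin n) →
                  total x < N → support x ⊆ᴬ K → IsFlow (u Vector.∷ S) T x → PathAndRemainder u S T
    extractPath (suc N) {S} {T} x u total<N x⊆K x-flow = by-target? (any? (λ j → T j ≟ᶠ u))
      where
      by-target? : Dec (∃ λ j → T j ≡ u) → PathAndRemainder u S T
      by-target? (yes (j , refl)) = j , ε , x , arrived , x⊆K
        where
        arrived : IsFlow S (removeAt T j) x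
        arrived v = +-cancelˡ-≡ (δ v u) _ _ (begin
          δ v u + (out x v + count (removeAt T j) v)   ≡⟨ x∙yz≈y∙xz (δ v u) (out x v) _ ⟩
          out x v + (δ v u + count (removeAt T j) v)   ≡⟨ cong (out x v +_) (sum-remove (λ i → δ v (T i))) ⟨
          out x v + count T v                          ≡⟨ x-flow v ⟩
          inn x v + (δ v u + count S v)                ≡⟨ x∙yz≈y∙xz (inn x v) (δ v u) _ ⟩
          δ v u + (inn x v + count S v)                ∎)
          where open ≡-Reasoning
      by-target? (no u∉T) = continue (extractPath N {S = S} {T} x₁ w total₁<N x₁⊆K x₁-flow)
        where
        u-leaves : 0 < out x u
        u-leaves = begin-strict
          0                               <⟨ s≤s z≤n ⟩
          1                               ≡⟨ δ-refl u ⟨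
          δ u u                           ≤⟨ m≤m+n (δ u u) (count S u) ⟩
          δ u u + count S u               ≤⟨ m≤n+m _ (inn x u) ⟩
          inn x u + (δ u u + count S u)   ≡⟨ x-flow u ⟨
          out x u + count T u             ≡⟨ cong (out x u +_) u-not-target ⟩
          out x u + 0                     ≡⟨ +-identityʳ (out x u) ⟩
          out x u                         ∎
          where
          open ≤-Reasoning
          u-not-target : count T u ≡ 0
          u-not-target = sum-zero (λ j → δ-≢ (λ u≡Tj → u∉T (j , sym u≡Tj)))

        w : Fin n
        w = proj₁ (sum-positive (x u) u-leaves)

        0<xuw : 0 < x u w
        0<xuw = proj₂ (sum-positive (x u) u-leaves)

        x₁ : Flow n
        x₁ a b = x a b ∸ unit u w a b

        x₁-exchange : ∀ a b → (x₁ ⊕ unit u w) a b ≡ x a b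
        x₁-exchange a b = m∸n+n≡m (unit-≤ 0<xuw a b)

        x₁-flow : IsFlow (w Vector.∷ S) T x₁
        x₁-flow v = shift (out x₁ v) (inn x₁ v) (out x v) (inn x v) (δ v u) (δ v w) (count T v) (count S v)
          (trans (cong (out x₁ v +_) (sym (out-unit u w v)))
                 (trans (sym (out-⊕ x₁ (unit u w) v)) (sum-cong-≗ (x₁-exchange v))))
          (trans (cong (inn x₁ v +_) (sym (inn-unit u w v)))
                 (trans (sym (inn-⊕ x₁ (unit u w) v)) (sum-cong-≗ (λ a → x₁-exchange a v))))
          (x-flow v)
          where
          shift : ∀ a₁ b₁ a b du dw cT cS → a₁ + du ≡ a → b₁ + dw ≡ b → a + cT ≡ b + (du + cS) →
                  a₁ + cT ≡ b₁ + (dw + cS)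
          shift a₁ b₁ a b du dw cT cS a₁+du≡a b₁+dw≡b a+cT≡b+du+cS = +-cancelʳ-≡ du _ _ (begin
            a₁ + cT + du          ≡⟨ solve (a₁ ∷ cT ∷ du ∷ []) ⟩
            a₁ + du + cT          ≡⟨ cong (_+ cT) a₁+du≡a ⟩
            a + cT                ≡⟨ a+cT≡b+du+cS ⟩
            b + (du + cS)         ≡⟨ cong (_+ (du + cS)) b₁+dw≡b ⟨
            b₁ + dw + (du + cS)   ≡⟨ solve (b₁ ∷ dw ∷ du ∷ cS ∷ []) ⟩
            b₁ + (dw + cS) + du   ∎)
            where open ≡-Reasoning

        total₁<N : total x₁ < N
        total₁<N = s≤s⁻¹ (begin-strict
          suc (total x₁)                ≡⟨ +-comm 1 (total x₁) ⟩
          total x₁ + 1                  ≡⟨ cong (total x₁ +_) (total-unit u w) ⟨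
          total x₁ + total (unit u w)   ≡⟨ total-⊕ x₁ (unit u w) ⟨
          total (x₁ ⊕ unit u w)         ≡⟨ total-cong x₁-exchange ⟩
          total x                       <⟨ total<N ⟩
          suc N                         ∎)
          where open ≤-Reasoning

        x₁⊆K : support x₁ ⊆ᴬ K
        x₁⊆K = ⊆ᴬ-trans (support-mono λ {a} {b} 0<x₁ → <-≤-trans 0<x₁ (m∸n≤m (x a b) (unit u w a b))) x⊆K

        continue : PathAndRemainder w S T → PathAndRemainder u S T
        continue (j , path , rest) = j , x⊆K u w (0<⇒positive 0<xuw) ◅ path , rest

    decompose : {S T : Fin k → Fin n} (x : Flow n) → IsFlow S T x → support x ⊆ᴬ K → Routes K S T
    decompose {zero}  _ _ _ = id , λ ()
    decompose {suc k} {S} {T} x x-flow x⊆K =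
      continue (extractPath (suc (total x)) {S = λ i → S (suc i)} {T} x (S zero) ≤-refl x⊆K x-flow)
      where
      continue : PathAndRemainder (S zero) (λ i → S (suc i)) T → Routes K S T
      continue (j , path , y , y-flow , y⊆K) with decompose y y-flow y⊆K
      ... | σ , paths = insert zero j σ , λ where
        zero    → path
        (suc i) → subst (λ t → Path K (S (suc i)) (T t)) (sym (insert-punchIn zero j σ i)) (paths i)

  forestSubsolution : (K : ArcSet n) {S T : Fin k → Fin n} → (∀ i → Path K (S i) (T i)) →
                      ∃ λ K′ → K′ ⊆ᴬ K × Routes K′ S T × Forest K′
  forestSubsolution K {S} {T} P = finish (acyclicReduct _ {S} {T} (routeFlow P) (n<1+n _) (routeFlow-isFlow P))
    where
    finish : AcyclicReduct S T (routeFlow P) → ∃ λ K′ → K′ ⊆ᴬ K × Routes K′ S T × Forest K′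
    finish (y , y-flow , y⊆x , acyclic) =
      support y , ⊆ᴬ-trans y⊆x (λ a b → routeFlow-positive P ∘′ positive⇒0<) ,
      decompose y y-flow (λ _ _ y⊆y → y⊆y) , loopless , acyclic
      where
      loopless : ∀ a → ¬ support y a a ≡ true
      loopless a yaa = <⇒≢ (positive⇒0< (y⊆x a a yaa)) (sym (routeFlow-loopless P a))

open Flows using (⊆ᴬ-trans; Routes; forestSubsolution)

open import Data.Rational using (_≤_; _+_)
import Data.Rational.Properties as ℚ
open import Data.Bool using (true; false; if_then_else_)
open import Data.List using (List; foldr; map; allFin)
open import Data.List.Relation.Binary.Pointwise as Pointwise using (Pointwise; []; _∷_; concat⁺; map⁺)
open import Relation.Binary.PropositionalEquality using (sym; trans)

foldr-+-mono : {xs ys : List ℚ} → Pointwise _≤_ xs ys → foldr _+_ 0ℚ xs ≤ foldr _+_ 0ℚ ys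
foldr-+-mono []            = ℚ.≤-refl
foldr-+-mono (x≤y ∷ xs≤ys) = ℚ.+-mono-≤ x≤y (foldr-+-mono xs≤ys)

weight-mono : {n : ℕ} (w : Fin n → Fin n → ℚ) → (∀ u v → 0ℚ ≤ w u v) →
              {K′ K : ArcSet n} → K′ ⊆ᴬ K → weight w K′ ≤ weight w K
weight-mono {n} w w≥0 {K′} {K} K′⊆K =
  foldr-+-mono (concat⁺ (map⁺ (row K′) (row K) (Pointwise.refl row-mono {allFin n})))
  where
  entry : ArcSet n → Fin n → Fin n → ℚ
  entry K u v = if K u v then w u v else 0ℚ

  row : ArcSet n → Fin n → List ℚ
  row K u = map (entry K u) (allFin n)

  entry-mono : ∀ u {v} → entry K′ u v ≤ entry K u v
  entry-mono u {v} with K′ u v in eq′ | K u v in eq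
  ... | false | false = ℚ.≤-refl
  ... | false | true  = w≥0 u v
  ... | true  | true  = ℚ.≤-refl
  ... | true  | false with trans (sym (K′⊆K u v eq′)) eq
  ...   | ()

  row-mono : ∀ {u} → Pointwise _≤_ (row K′ u) (row K u)
  row-mono {u} = map⁺ (entry K′ u) (entry K u) (Pointwise.refl (entry-mono u))

lemma3 : (n k : ℕ) (A : ArcSet n) (w : Fin n → Fin n → ℚ) →
         (∀ u v → 0ℚ ≤ w u v) →
         (S T : Fin k → Fin n) (ℓ : ℤ) →
         ∃ (IsSolution A w S T ℓ) →
         ∃ λ K → IsSolution A w S T ℓ K × Forest K
lemma3 n k A w w≥0 S T ℓ (K , K⊆A , weight≤ℓ , σ , paths) = restrict (forestSubsolution K paths)
  where
  restrict : (∃ λ K′ → K′ ⊆ᴬ K × Routes K′ S (λ i → T (σ ⟨$⟩ʳ i)) × Forest K′) →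
             ∃ λ K′ → IsSolution A w S T ℓ K′ × Forest K′
  restrict (K′ , K′⊆K , (τ , paths′) , forest) =
    K′ , (⊆ᴬ-trans K′⊆K K⊆A , ℚ.≤-trans (weight-mono w w≥0 K′⊆K) weight≤ℓ , τ ∘ₚ σ , paths′) ,
    forest
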